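{- Let $(H,f)$ be a vertex-weighted graph with $H$ connected. Suppose $H$ has a triangle $x_1x_2x_3$ such that $\deg_H(x_1)=\deg_H(x_2)=2$ and $f(x_1)=f(x_2)=0$. Let $(\tilde H,\tilde f)$ be obtained from $(H,f)$ by deleting the edge $x_1x_2$ and setting $\tilde f(x_1)=\tilde f(x_2)=1$ (so $x_1,x_2$ become vertices of degree $1$ and weight $1$), with $\tilde f=f$ elsewhere. Then all eigenvalues of $\mathcal{Q}(H,f)$ are integers if and only if all eigenvalues of $\mathcal{Q}(\tilde H,\tilde f)$ are integers.
   Context: A vertex-weighted graph $(H,f)$ is a finite simple graph $H$ with $f:V(H)\to\mathbb{Z}_{\ge0}$. $\mathcal{Q}(H,f)=A(H)+\Delta(H)+2\Delta_f$ where $A(H)$ is the adjacency matrix, $\Delta(H)$ the diagonal matrix of degrees, and $(\Delta_f)_{xx}=f(x)$. -}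

module Defs where

open import Data.Nat as ℕ using (ℕ; zero; suc)
open import Data.Integer as ℤ using (ℤ; +_; -_; _-_; _*_; _+_)
open import Data.Fin using (Fin; zero; suc; punchIn)
open import Data.Fin.Properties using (_≟_)
open import Data.Bool using (Bool; true; false; if_then_else_; _∧_; _∨_; not)
open import Data.Product using (Σ)
open import Relation.Nullary.Decidable using (⌊_⌋)
open import Relation.Binary.PropositionalEquality using (_≡_)

Adj : ℕ → Set
Adj n = Fin n → Fin n → Bool

IsSimple : ∀ {n} → Adj n → Set
IsSimple {n} a = (∀ (i j : Fin n) → a i j ≡ a j i) × (∀ (i : Fin n) → a i i ≡ false)
  where open import Data.Product using (_×_)

data Reach {n} (a : Adj n) : Fin n → Fin n → Set where
  here : ∀ {u} → Reach a u u
  step : ∀ {u w v} → a u w ≡ true → Reach a w v → Reach a u v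

Connected : ∀ {n} → Adj n → Set
Connected {n} a = ∀ (u v : Fin n) → Reach a u v

Σℕ : ∀ {n} → (Fin n → ℕ) → ℕ
Σℕ {zero} g = 0
Σℕ {suc n} g = g zero ℕ.+ Σℕ (λ i → g (suc i))

Σℤ : ∀ {n} → (Fin n → ℤ) → ℤ
Σℤ {zero} g = + 0
Σℤ {suc n} g = g zero + Σℤ (λ i → g (suc i))

Πℤ : ∀ {n} → (Fin n → ℤ) → ℤ
Πℤ {zero} g = + 1
Πℤ {suc n} g = g zero * Πℤ (λ i → g (suc i))

deg : ∀ {n} → Adj n → Fin n → ℕ
deg a i = Σℕ (λ j → if a i j then 1 else 0)

_==_ : ∀ {n} → Fin n → Fin n → Bool
i == j = ⌊ i ≟ j ⌋

Matrix : ℕ → Set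
Matrix n = Fin n → Fin n → ℤ

sign : ∀ {n} → Fin n → ℤ
sign zero = + 1
sign (suc j) = - sign j

det : ∀ {n} → Matrix n → ℤ
det {zero} M = + 1
det {suc n} M = Σℤ (λ j → sign j * M zero j * det (λ r c → M (suc r) (punchIn j c)))

-- Q(H,f) = A(H) + Δ(H) + 2 Δ_f
Qmat : ∀ {n} → Adj n → (Fin n → ℕ) → Matrix n
Qmat a f i j =
  (if a i j then + 1 else + 0) + (if i == j then + (deg a i ℕ.+ 2 ℕ.* f i) else + 0)

charPoly : ∀ {n} → Matrix n → ℤ → ℤ
charPoly M t = det (λ i j → (if i == j then t else + 0) - M i j)

-- all eigenvalues (roots of the characteristic polynomial, with multiplicity)
-- are integers: det(tI - M) = ∏ (t - λᵢ) for integers λ₁..λₙ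
-- (identity of integer polynomials, equivalently identity at all t ∈ ℤ)
IntegralSpectrum : ∀ {n} → Matrix n → Set
IntegralSpectrum {n} M = Σ (Fin n → ℤ) (λ ev → ∀ (t : ℤ) → charPoly M t ≡ Πℤ (λ i → t - ev i))

deleteEdge : ∀ {n} → Adj n → Fin n → Fin n → Adj n
deleteEdge a x y i j = a i j ∧ not ((i == x ∧ j == y) ∨ (i == y ∧ j == x))

reweight : ∀ {n} → (Fin n → ℕ) → Fin n → Fin n → Fin n → ℕ
reweight f x y i = if (i == x ∨ i == y) then 1 else f i

{-# OPTIONS --safe #-}
module Submission where

-- Write M(t) = tI − Q(H,f), M̃(t) = tI − Q(H̃,f̃) and e = δ x₁ − δ x₂.  As x₁ and x₂ are adjacent
-- only to each other and to x₃, row x₁ of M(t) is (t − 1)e plus row x₂ of M(t), row x₁ of M̃(t) is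
-- (t − 3)e plus row x₂ of M̃(t), the two rows x₂ differ by −e, and all other rows agree.  Row
-- linearity and alternation of det give det M(t) = (t − 1)D(t) and det M̃(t) = (t − 3)D(t) for one
-- and the same D: the spectra differ by trading an eigenvalue 1 for an eigenvalue 3.  To divide a
-- factorisation ∏ (t − λᵢ) by t − 1 without a theory of polynomials, note that D, a determinant
-- with entries linear in t, satisfies a − b ∣ D a − D b, and two such functions that agree away from
-- one point agree everywhere.

open import Defs
open import Data.Nat using (ℕ)
open import Data.Fin using (Fin)
open import Data.Bool using (true)
open import Relation.Binary.PropositionalEquality using (_≡_; _≢_)
open import Function.Bundles using (_⇔_)

open import Data.Nat as ℕ using (zero; suc; _≤_)
import Data.Nat.Properties as ℕ
open import Data.Nat.Divisibility using (>⇒∤) renaming (_∣_ to _∣ℕ_)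
open import Data.Integer as ℤ using (ℤ; +_; -_; _-_; _*_; _+_; ∣_∣)
import Data.Integer.Properties as ℤ
open import Data.Integer.Divisibility.Signed
  using (_∣_; divides; ∣-refl; ∣m∣n⇒∣m+n; ∣m∣n⇒∣m-n; ∣n⇒∣m*n; ∣m⇒∣m*n; ∣m⇒∣-m; ∣⇒∣ᵤ)
open import Data.Integer.Tactic.RingSolver using (solve-∀)
open import Data.Fin as Fin using (zero; suc; punchIn; punchOut)
open import Data.Fin.Properties using (_≟_; suc-injective; punchInᵢ≢i; punchIn-punchOut)
open import Data.Bool using (Bool; false; if_then_else_; _∧_; _∨_; not)
open import Data.Bool.Properties using (∨-identityʳ; ∨-comm; ∨-zeroʳ; ∧-identityʳ; ∧-zeroʳ)
open import Data.Product using (Σ; _,_)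
open import Data.Sum using (inj₁; inj₂)
open import Data.Empty using (⊥-elim)
open import Data.Vec.Functional using (insertAt; updateAt)
open import Data.Vec.Functional.Properties
  using (insertAt-lookup; insertAt-punchIn; updateAt-updates; updateAt-minimal)
open import Algebra.Properties.CommutativeSemigroup ℕ.+-commutativeSemigroup using (x∙yz≈y∙xz)
open import Relation.Nullary using (Dec; yes; no; ¬_)
open import Relation.Binary.PropositionalEquality
  using (refl; sym; trans; cong; cong₂; cong-app; subst; subst₂; ≢-sym; module ≡-Reasoning)
open import Function using (_∘_; const)
open import Function.Bundles using (mk⇔)

open ≡-Reasoning


==-refl : ∀ {n} (i : Fin n) → (i == i) ≡ true
==-refl i with i ≟ i
... | yes _ = refl
... | no i≢i = ⊥-elim (i≢i refl)

==-≢ : ∀ {n} {i j : Fin n} → i ≢ j → (i == j) ≡ false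
==-≢ {i = i} {j} i≢j with i ≟ j
... | yes i≡j = ⊥-elim (i≢j i≡j)
... | no _ = refl

==-suc : ∀ {n} (i j : Fin n) → (Fin.suc i == suc j) ≡ (i == j)
==-suc i j with i ≟ j
... | yes _ = refl
... | no _ = refl

Σℤ-cong : ∀ {n} {g h : Fin n → ℤ} → (∀ i → g i ≡ h i) → Σℤ g ≡ Σℤ h
Σℤ-cong {zero} g≗h = refl
Σℤ-cong {suc n} g≗h = cong₂ _+_ (g≗h zero) (Σℤ-cong (g≗h ∘ suc))

Σℤ-zero : ∀ {n} {g : Fin n → ℤ} → (∀ i → g i ≡ + 0) → Σℤ g ≡ + 0
Σℤ-zero {zero} g≗0 = refl
Σℤ-zero {suc n} g≗0 = cong₂ _+_ (g≗0 zero) (Σℤ-zero (g≗0 ∘ suc))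

Σℤ-+ : ∀ {n} (g h : Fin n → ℤ) → Σℤ (λ i → g i + h i) ≡ Σℤ g + Σℤ h
Σℤ-+ {zero} g h = refl
Σℤ-+ {suc n} g h = trans (cong (λ s → g zero + h zero + s) (Σℤ-+ (g ∘ suc) (h ∘ suc)))
  (interchange (g zero) (h zero) (Σℤ (g ∘ suc)) (Σℤ (h ∘ suc)))
  where
  interchange : ∀ a b x y → (a + b) + (x + y) ≡ (a + x) + (b + y)
  interchange = solve-∀

Σℤ-*ˡ : ∀ {n} (c : ℤ) (g : Fin n → ℤ) → Σℤ (λ i → c * g i) ≡ c * Σℤ g
Σℤ-*ˡ {zero} c g = sym (ℤ.*-zeroʳ c)
Σℤ-*ˡ {suc n} c g = trans (cong (λ s → c * g zero + s) (Σℤ-*ˡ c (g ∘ suc))) (sym (ℤ.*-distribˡ-+ c _ _))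

Σℤ-linear : ∀ {n} (c : ℤ) (g h : Fin n → ℤ) → Σℤ (λ i → c * g i + h i) ≡ c * Σℤ g + Σℤ h
Σℤ-linear c g h = trans (Σℤ-+ (λ i → c * g i) h) (cong (_+ Σℤ h) (Σℤ-*ˡ c g))

Σℤ-neg : ∀ {n} (g : Fin n → ℤ) → Σℤ (λ i → - g i) ≡ - Σℤ g
Σℤ-neg {zero} g = refl
Σℤ-neg {suc n} g = trans (cong (λ s → - g zero + s) (Σℤ-neg (g ∘ suc))) (sym (ℤ.neg-distrib-+ (g zero) _))

Σℤ-comm : ∀ {m n} (g : Fin m → Fin n → ℤ) → Σℤ (λ i → Σℤ (g i)) ≡ Σℤ (λ j → Σℤ (λ i → g i j))
Σℤ-comm {zero} {n} g = sym (Σℤ-zero {n} (λ _ → refl))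
Σℤ-comm {suc m} g = trans (cong (λ s → Σℤ (g zero) + s) (Σℤ-comm (g ∘ suc))) (sym (Σℤ-+ (g zero) _))

Σℤ-remove : ∀ {n} (g : Fin (suc n) → ℤ) (k : Fin (suc n)) → Σℤ g ≡ g k + Σℤ (g ∘ punchIn k)
Σℤ-remove g zero = refl
Σℤ-remove {suc n} g (suc k) = trans (cong (λ s → g zero + s) (Σℤ-remove (g ∘ suc) k))
  (swap (g zero) (g (suc k)) (Σℤ (g ∘ suc ∘ punchIn k)))
  where
  swap : ∀ a b c → a + (b + c) ≡ b + (a + c)
  swap = solve-∀

Σℤ-insertAt : ∀ {n} (g : Fin n → ℤ) (j : Fin (suc n)) → Σℤ (insertAt g j (+ 0)) ≡ Σℤ g
Σℤ-insertAt g j = begin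
  Σℤ (insertAt g j (+ 0))
    ≡⟨ Σℤ-remove (insertAt g j (+ 0)) j ⟩
  insertAt g j (+ 0) j + Σℤ (insertAt g j (+ 0) ∘ punchIn j)
    ≡⟨ cong₂ _+_ (insertAt-lookup g j (+ 0)) (Σℤ-cong (insertAt-punchIn g j (+ 0))) ⟩
  + 0 + Σℤ g
    ≡⟨ ℤ.+-identityˡ (Σℤ g) ⟩
  Σℤ g ∎

Πℤ-cong : ∀ {n} {g h : Fin n → ℤ} → (∀ i → g i ≡ h i) → Πℤ g ≡ Πℤ h
Πℤ-cong {zero} g≗h = refl
Πℤ-cong {suc n} g≗h = cong₂ _*_ (g≗h zero) (Πℤ-cong (g≗h ∘ suc))

Πℤ-remove : ∀ {n} (g : Fin (suc n) → ℤ) (k : Fin (suc n)) → Πℤ g ≡ g k * Πℤ (g ∘ punchIn k)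
Πℤ-remove g zero = refl
Πℤ-remove {suc n} g (suc k) = trans (cong (g zero *_) (Πℤ-remove (g ∘ suc) k))
  (swap (g zero) (g (suc k)) (Πℤ (g ∘ suc ∘ punchIn k)))
  where
  swap : ∀ a b c → a * (b * c) ≡ b * (a * c)
  swap = solve-∀

Πℤ≡0⇒∃zero : ∀ {n} (g : Fin n → ℤ) → Πℤ g ≡ + 0 → Σ (Fin n) (λ k → g k ≡ + 0)
Πℤ≡0⇒∃zero {zero} g ()
Πℤ≡0⇒∃zero {suc n} g Πg≡0 with ℤ.i*j≡0⇒i≡0∨j≡0 (g zero) Πg≡0
... | inj₁ g₀≡0 = zero , g₀≡0
... | inj₂ Πg′≡0 with Πℤ≡0⇒∃zero (g ∘ suc) Πg′≡0
...   | k , gk≡0 = suc k , gk≡0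

Σℕ-cong : ∀ {n} {g h : Fin n → ℕ} → (∀ i → g i ≡ h i) → Σℕ g ≡ Σℕ h
Σℕ-cong {zero} g≗h = refl
Σℕ-cong {suc n} g≗h = cong₂ ℕ._+_ (g≗h zero) (Σℕ-cong (g≗h ∘ suc))

dropAt : ∀ {n} → Fin n → (Fin n → ℕ) → Fin n → ℕ
dropAt p g i = if i == p then 0 else g i

dropAt-≢ : ∀ {n} {p i : Fin n} (g : Fin n → ℕ) → i ≢ p → dropAt p g i ≡ g i
dropAt-≢ g i≢p rewrite ==-≢ i≢p = refl

Σℕ-split : ∀ {n} (g : Fin n → ℕ) (p : Fin n) → Σℕ g ≡ g p ℕ.+ Σℕ (dropAt p g)
Σℕ-split g zero = refl
Σℕ-split {suc (suc n)} g (suc p) = begin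
  g zero ℕ.+ Σℕ (g ∘ suc)
    ≡⟨ cong (g zero ℕ.+_) (Σℕ-split (g ∘ suc) p) ⟩
  g zero ℕ.+ (g (suc p) ℕ.+ Σℕ (dropAt p (g ∘ suc)))
    ≡⟨ x∙yz≈y∙xz (g zero) (g (suc p)) _ ⟩
  g (suc p) ℕ.+ (g zero ℕ.+ Σℕ (dropAt p (g ∘ suc)))
    ≡⟨ cong (λ s → g (suc p) ℕ.+ (g zero ℕ.+ s))
            (Σℕ-cong λ i → cong (λ b → if b then 0 else g (suc i)) (sym (==-suc i p))) ⟩
  g (suc p) ℕ.+ Σℕ (dropAt (suc p) g) ∎

Σℕ-≥ : ∀ {n} (g : Fin n → ℕ) (p : Fin n) → g p ≤ Σℕ g
Σℕ-≥ g p = subst (g p ≤_) (sym (Σℕ-split g p)) (ℕ.m≤m+n (g p) _)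

Σℕ-≥-three : ∀ {n} (g : Fin n → ℕ) {p q r : Fin n} → q ≢ p → r ≢ p → r ≢ q →
             g p ℕ.+ (g q ℕ.+ g r) ≤ Σℕ g
Σℕ-≥-three g {p} {q} {r} q≢p r≢p r≢q =
  subst₂ _≤_ (cong (g p ℕ.+_) (cong₂ ℕ._+_ (dropAt-≢ g q≢p) (trans (dropAt-≢ g₁ r≢q) (dropAt-≢ g r≢p))))
             (sym (trans (Σℕ-split g p) (cong (g p ℕ.+_) (Σℕ-split g₁ q))))
             (ℕ.+-monoʳ-≤ (g p) (ℕ.+-monoʳ-≤ (g₁ q) (Σℕ-≥ (dropAt q g₁) r)))
  where
  g₁ = dropAt p g

i≡-i⇒i≡0 : ∀ (i : ℤ) → i ≡ - i → i ≡ + 0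
i≡-i⇒i≡0 (+ zero) _ = refl
i≡-i⇒i≡0 (+ suc n) ()
i≡-i⇒i≡0 ℤ.-[1+ n ] ()

insertAt-punchOut : ∀ {n} {A : Set} (g : Fin n → A) {j b : Fin (suc n)} (v : A) (j≢b : j ≢ b) →
                    insertAt g j v b ≡ g (punchOut j≢b)
insertAt-punchOut g {j} v j≢b =
  trans (cong (insertAt g j v) (sym (punchIn-punchOut j≢b))) (insertAt-punchIn g j v _)

punchIn-punchOut-comm : ∀ {n} {i j : Fin (suc (suc n))} (i≢j : i ≢ j) (j≢i : j ≢ i) (c : Fin n) →
                        punchIn i (punchIn (punchOut i≢j) c) ≡ punchIn j (punchIn (punchOut j≢i) c)
punchIn-punchOut-comm {i = zero} {zero} i≢j _ c = ⊥-elim (i≢j refl)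
punchIn-punchOut-comm {i = zero} {suc j} _ _ c = refl
punchIn-punchOut-comm {i = suc i} {zero} _ _ c = refl
punchIn-punchOut-comm {suc n} {suc i} {suc j} _ _ zero = refl
punchIn-punchOut-comm {suc n} {suc i} {suc j} i≢j j≢i (suc c) =
  cong suc (punchIn-punchOut-comm (i≢j ∘ cong suc) (j≢i ∘ cong suc) c)
punchIn-punchOut-comm {zero} {suc zero} {suc zero} i≢j _ c = ⊥-elim (i≢j refl)

sign-punchOut-anticomm : ∀ {n} {i j : Fin (suc (suc n))} (i≢j : i ≢ j) (j≢i : j ≢ i) →
                         sign i * sign (punchOut i≢j) ≡ - (sign j * sign (punchOut j≢i))
sign-punchOut-anticomm {i = zero} {zero} i≢j _ = ⊥-elim (i≢j refl)
sign-punchOut-anticomm {i = zero} {suc j} _ _ = lemma (sign j)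
  where
  lemma : ∀ s → + 1 * s ≡ - (- s * + 1)
  lemma = solve-∀
sign-punchOut-anticomm {i = suc i} {zero} _ _ = lemma (sign i)
  where
  lemma : ∀ s → - s * + 1 ≡ - (+ 1 * s)
  lemma = solve-∀
sign-punchOut-anticomm {suc n} {suc i} {suc j} i≢j j≢i = begin
  - sign i * - sign (punchOut i≢j′)   ≡⟨ neg*neg (sign i) _ ⟩
  sign i * sign (punchOut i≢j′)       ≡⟨ sign-punchOut-anticomm i≢j′ j≢i′ ⟩
  - (sign j * sign (punchOut j≢i′))   ≡⟨ cong -_ (neg*neg (sign j) _) ⟨
  - (- sign j * - sign (punchOut j≢i′)) ∎
  where
  i≢j′ = i≢j ∘ cong suc
  j≢i′ = j≢i ∘ cong suc
  neg*neg : ∀ a b → - a * - b ≡ a * b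
  neg*neg = solve-∀
sign-punchOut-anticomm {zero} {suc zero} {suc zero} i≢j _ = ⊥-elim (i≢j refl)

minor : ∀ {n} → Matrix (suc n) → Fin (suc n) → Matrix n
minor M j r c = M (suc r) (punchIn j c)

expansionTerm : ∀ {n} → Matrix (suc n) → Fin (suc n) → ℤ
expansionTerm M j = sign j * M zero j * det (minor M j)

det-cong : ∀ {n} {M N : Matrix n} → (∀ i j → M i j ≡ N i j) → det M ≡ det N
det-cong {zero} M≈N = refl
det-cong {suc n} M≈N = Σℤ-cong λ j →
  cong₂ (λ m d → sign j * m * d) (M≈N zero j) (det-cong λ r c → M≈N (suc r) (punchIn j c))

det-linear : ∀ {n} (r : Fin n) (c : ℤ) {M U V : Matrix n} →
  (∀ j → M r j ≡ c * U r j + V r j) →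
  (∀ i → i ≢ r → ∀ j → U i j ≡ M i j) →
  (∀ i → i ≢ r → ∀ j → V i j ≡ M i j) →
  det M ≡ c * det U + det V
det-linear {suc n} zero c {M} {U} {V} Mr U≈M V≈M =
  trans (Σℤ-cong term) (Σℤ-linear c (expansionTerm U) (expansionTerm V))
  where
  distrib : ∀ c s a b d → s * (c * a + b) * d ≡ c * (s * a * d) + s * b * d
  distrib = solve-∀
  term : ∀ j → expansionTerm M j ≡ c * expansionTerm U j + expansionTerm V j
  term j = begin
    sign j * M zero j * det (minor M j)
      ≡⟨ cong₂ (λ m d → sign j * m * d) (Mr j) (det-cong λ i k → sym (U≈M (suc i) (λ ()) _)) ⟩
    sign j * (c * U zero j + V zero j) * det (minor U j)
      ≡⟨ distrib c (sign j) (U zero j) (V zero j) _ ⟩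
    c * expansionTerm U j + sign j * V zero j * det (minor U j)
      ≡⟨ cong (λ d → c * expansionTerm U j + sign j * V zero j * d)
              (det-cong λ i k → trans (U≈M (suc i) (λ ()) _) (sym (V≈M (suc i) (λ ()) _))) ⟩
    c * expansionTerm U j + expansionTerm V j ∎
det-linear {suc n} (suc r) c {M} {U} {V} Mr U≈M V≈M =
  trans (Σℤ-cong term) (Σℤ-linear c (expansionTerm U) (expansionTerm V))
  where
  distrib : ∀ c m x y → m * (c * x + y) ≡ c * (m * x) + m * y
  distrib = solve-∀
  term : ∀ j → expansionTerm M j ≡ c * expansionTerm U j + expansionTerm V j
  term j = begin
    sign j * M zero j * det (minor M j)
      ≡⟨ cong (sign j * M zero j *_)
              (det-linear r c (Mr ∘ punchIn j) (λ i i≢r k → U≈M (suc i) (i≢r ∘ suc-injective) _)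
                                              (λ i i≢r k → V≈M (suc i) (i≢r ∘ suc-injective) _)) ⟩
    sign j * M zero j * (c * det (minor U j) + det (minor V j))
      ≡⟨ distrib c (sign j * M zero j) _ _ ⟩
    c * (sign j * M zero j * det (minor U j)) + sign j * M zero j * det (minor V j)
      ≡⟨ cong₂ (λ a b → c * (sign j * a * det (minor U j)) + sign j * b * det (minor V j))
               (sym (U≈M zero (λ ()) j)) (sym (V≈M zero (λ ()) j)) ⟩
    c * expansionTerm U j + expansionTerm V j ∎

det-additive : ∀ {n} (r : Fin n) {M U V : Matrix n} →
  (∀ j → M r j ≡ U r j + V r j) →
  (∀ i → i ≢ r → ∀ j → U i j ≡ M i j) →
  (∀ i → i ≢ r → ∀ j → V i j ≡ M i j) →
  det M ≡ det U + det V
det-additive r {U = U} {V} Mr U≈M V≈M =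
  trans (det-linear r (+ 1) (λ j → trans (Mr j) (cong (_+ V r j) (sym (ℤ.*-identityˡ (U r j))))) U≈M V≈M)
        (cong (_+ det V) (ℤ.*-identityˡ (det U)))

-- Expanding along both rows writes det M as a double sum over ordered pairs of columns j ≠ b
-- whose terms Z j b are antisymmetric, so det M = − det M.
det-rows₀₁-equal : ∀ {n} (M : Matrix (suc (suc n))) → (∀ j → M zero j ≡ M (suc zero) j) → det M ≡ + 0
det-rows₀₁-equal {n} M row₀≡row₁ = i≡-i⇒i≡0 (det M) (begin
  det M                          ≡⟨ det≡ΣZ ⟩
  Σℤ (λ j → Σℤ (Z j))            ≡⟨ Σℤ-comm Z ⟩
  Σℤ (λ b → Σℤ (λ j → Z j b))    ≡⟨ Σℤ-cong (λ b → trans (Σℤ-cong (λ j → Z-antisym j b)) (Σℤ-neg (Z b))) ⟩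
  Σℤ (λ b → - Σℤ (Z b))          ≡⟨ Σℤ-neg (λ b → Σℤ (Z b)) ⟩
  - Σℤ (λ b → Σℤ (Z b))          ≡⟨ cong -_ det≡ΣZ ⟨
  - det M                        ∎)
  where
  u = M zero
  R : Fin (suc (suc n)) → Fin (suc n) → ℤ
  R j k = det (minor (minor M j) k)
  term : Fin (suc (suc n)) → Fin (suc n) → ℤ
  term j k = sign j * u j * (sign k * u (punchIn j k) * R j k)
  Z : Fin (suc (suc n)) → Fin (suc (suc n)) → ℤ
  Z j = insertAt (term j) j (+ 0)

  det≡ΣZ : det M ≡ Σℤ (λ j → Σℤ (Z j))
  det≡ΣZ = Σℤ-cong λ j → begin
    sign j * u j * det (minor M j)
      ≡⟨ cong (sign j * u j *_) (Σℤ-cong λ k →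
           cong (λ x → sign k * x * R j k) (sym (row₀≡row₁ (punchIn j k)))) ⟩
    sign j * u j * Σℤ (λ k → sign k * u (punchIn j k) * R j k)
      ≡⟨ Σℤ-*ˡ (sign j * u j) (λ k → sign k * u (punchIn j k) * R j k) ⟨
    Σℤ (term j)
      ≡⟨ Σℤ-insertAt (term j) j ⟨
    Σℤ (Z j) ∎

  antisym : ∀ sj sp sb sq uj ub X → sj * sp ≡ - (sb * sq) →
            sj * uj * (sp * ub * X) ≡ - (sb * ub * (sq * uj * X))
  antisym sj sp sb sq uj ub X sjsp≡-sbsq = begin
    sj * uj * (sp * ub * X)      ≡⟨ regroup sj sp uj ub X ⟩
    sj * sp * (uj * ub * X)      ≡⟨ cong (_* (uj * ub * X)) sjsp≡-sbsq ⟩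
    - (sb * sq) * (uj * ub * X)  ≡⟨ regroup⁻ sb sq uj ub X ⟩
    - (sb * ub * (sq * uj * X))  ∎
    where
    regroup : ∀ sj sp uj ub X → sj * uj * (sp * ub * X) ≡ sj * sp * (uj * ub * X)
    regroup = solve-∀
    regroup⁻ : ∀ sb sq uj ub X → - (sb * sq) * (uj * ub * X) ≡ - (sb * ub * (sq * uj * X))
    regroup⁻ = solve-∀

  Z-antisym : ∀ j b → Z j b ≡ - Z b j
  Z-antisym j b with j ≟ b
  ... | yes refl = trans (insertAt-lookup (term j) j (+ 0)) (cong -_ (sym (insertAt-lookup (term j) j (+ 0))))
  ... | no j≢b = begin
    Z j b                                      ≡⟨ insertAt-punchOut (term j) (+ 0) j≢b ⟩
    sign j * u j * (sign p * u (punchIn j p) * R j p)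
      ≡⟨ cong₂ (λ c x → sign j * u j * (sign p * u c * x)) (punchIn-punchOut j≢b) R-comm ⟩
    sign j * u j * (sign p * u b * R b q)
      ≡⟨ antisym (sign j) (sign p) (sign b) (sign q) (u j) (u b) (R b q) (sign-punchOut-anticomm j≢b b≢j) ⟩
    - (sign b * u b * (sign q * u j * R b q))
      ≡⟨ cong (λ c → - (sign b * u b * (sign q * u c * R b q))) (punchIn-punchOut b≢j) ⟨
    - term b q                                 ≡⟨ cong -_ (insertAt-punchOut (term b) (+ 0) b≢j) ⟨
    - Z b j                                    ∎
    where
    b≢j = ≢-sym j≢b
    p = punchOut j≢b
    q = punchOut b≢j
    R-comm : R j p ≡ R b q
    R-comm = det-cong λ r c → cong (M (suc (suc r))) (punchIn-punchOut-comm j≢b b≢j c)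

record RowSwap {n} (r s : Fin n) (M M′ : Matrix n) : Set where
  field
    at-r : ∀ j → M′ r j ≡ M s j
    at-s : ∀ j → M′ s j ≡ M r j
    elsewhere : ∀ i → i ≢ r → i ≢ s → ∀ j → M′ i j ≡ M i j

RowSwap-minor : ∀ {n} {r s : Fin n} {M M′ : Matrix (suc n)} →
                RowSwap (suc r) (suc s) M M′ → ∀ j → RowSwap r s (minor M j) (minor M′ j)
RowSwap-minor swap j = record
  { at-r = at-r ∘ punchIn j
  ; at-s = at-s ∘ punchIn j
  ; elsewhere = λ i i≢r i≢s → elsewhere (suc i) (i≢r ∘ suc-injective) (i≢s ∘ suc-injective) ∘ punchIn j
  }
  where open RowSwap swap

withRows : ∀ {n} → Fin n → Fin n → (x y : Fin n → ℤ) → Matrix n → Matrix n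
withRows r s x y M i = if i == r then x else if i == s then y else M i

withRows-r : ∀ {n} (r s : Fin n) x y M → withRows r s x y M r ≡ x
withRows-r r s x y M rewrite ==-refl r = refl

withRows-s : ∀ {n} {r s : Fin n} → r ≢ s → ∀ x y M → withRows r s x y M s ≡ y
withRows-s {s = s} r≢s x y M rewrite ==-≢ (≢-sym r≢s) | ==-refl s = refl

withRows-elsewhere : ∀ {n} {r s i : Fin n} → i ≢ r → i ≢ s → ∀ x y M → withRows r s x y M i ≡ M i
withRows-elsewhere i≢r i≢s x y M rewrite ==-≢ i≢r | ==-≢ i≢s = refl

withRows-≢r : ∀ {n} {r s i : Fin n} → i ≢ r → ∀ x x′ y M → withRows r s x y M i ≡ withRows r s x′ y M i
withRows-≢r i≢r x x′ y M rewrite ==-≢ i≢r = refl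

withRows-≢s : ∀ {n} {r s i : Fin n} → i ≢ s → ∀ x y y′ M → withRows r s x y M i ≡ withRows r s x y′ M i
withRows-≢s i≢s x y y′ M rewrite ==-≢ i≢s = refl

withRows-unique : ∀ {n} {r s : Fin n} → r ≢ s → {x y : Fin n → ℤ} {M N : Matrix n} →
  (∀ j → N r j ≡ x j) → (∀ j → N s j ≡ y j) → (∀ i → i ≢ r → i ≢ s → ∀ j → N i j ≡ M i j) →
  ∀ i j → N i j ≡ withRows r s x y M i j
withRows-unique {r = r} {s} r≢s {x} {y} {M} {N} N-r N-s N-elsewhere i j = byCases (i ≟ r) (i ≟ s)
  where
  byCases : Dec (i ≡ r) → Dec (i ≡ s) → N i j ≡ withRows r s x y M i j
  byCases (yes refl) _ = trans (N-r j) (sym (cong-app (withRows-r r s x y M) j))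
  byCases (no _) (yes refl) = trans (N-s j) (sym (cong-app (withRows-s r≢s x y M) j))
  byCases (no i≢r) (no i≢s) =
    trans (N-elsewhere i i≢r i≢s j) (sym (cong-app (withRows-elsewhere i≢r i≢s x y M) j))

RowSwap-withRows : ∀ {n} {r s : Fin n} → r ≢ s → ∀ M → RowSwap r s M (withRows r s (M s) (M r) M)
RowSwap-withRows {r = r} {s} r≢s M = record
  { at-r = cong-app (withRows-r r s (M s) (M r) M)
  ; at-s = cong-app (withRows-s r≢s (M s) (M r) M)
  ; elsewhere = λ i i≢r i≢s → cong-app (withRows-elsewhere i≢r i≢s (M s) (M r) M)
  }

mutual
  det-alternating : ∀ {n} {r s : Fin n} (M : Matrix n) → r ≢ s → (∀ j → M r j ≡ M s j) → det M ≡ + 0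
  det-alternating {r = zero} {zero} M r≢s _ = ⊥-elim (r≢s refl)
  det-alternating {r = zero} {suc s} M _ Mr≡Ms = det-alternating₀ s M Mr≡Ms
  det-alternating {r = suc r} {zero} M _ Mr≡Ms = det-alternating₀ r M (sym ∘ Mr≡Ms)
  det-alternating {r = suc r} {suc s} M r≢s Mr≡Ms = Σℤ-zero λ j →
    trans (cong (sign j * M zero j *_) (det-alternating (minor M j) (r≢s ∘ cong suc) (Mr≡Ms ∘ punchIn j)))
          (ℤ.*-zeroʳ (sign j * M zero j))

  det-alternating₀ : ∀ {n} (s : Fin n) (M : Matrix (suc n)) → (∀ j → M zero j ≡ M (suc s) j) → det M ≡ + 0
  det-alternating₀ zero M M₀≡M₁ = det-rows₀₁-equal M M₀≡M₁
  det-alternating₀ (suc s) M M₀≡Ms = begin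
    det M        ≡⟨ ℤ.neg-involutive (det M) ⟨
    - - det M    ≡⟨ cong -_ (det-swap-suc {r = zero} {suc s} (λ ()) (RowSwap-withRows (λ ()) M)) ⟨
    - det M′     ≡⟨ cong -_ (det-rows₀₁-equal M′ M₀≡Ms) ⟩
    - + 0        ∎
    where
    -- swapping rows 1 and s + 2 brings the two equal rows to the top
    M′ = withRows (suc zero) (suc (suc s)) (M (suc (suc s))) (M (suc zero)) M

  det-swap-suc : ∀ {n} {r s : Fin n} {M M′ : Matrix (suc n)} →
                 r ≢ s → RowSwap (suc r) (suc s) M M′ → det M′ ≡ - det M
  det-swap-suc {M = M} {M′} r≢s swap =
    trans (Σℤ-cong term) (Σℤ-neg (expansionTerm M))
    where
    term : ∀ j → expansionTerm M′ j ≡ - expansionTerm M j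
    term j = begin
      sign j * M′ zero j * det (minor M′ j)
        ≡⟨ cong₂ (λ m d → sign j * m * d) (RowSwap.elsewhere swap zero (λ ()) (λ ()) j)
                                          (det-swap r≢s (RowSwap-minor swap j)) ⟩
      sign j * M zero j * - det (minor M j)
        ≡⟨ ℤ.neg-distribʳ-* (sign j * M zero j) _ ⟨
      - expansionTerm M j ∎

  -- D x y, the determinant with rows r and s replaced by x and y, is bilinear and vanishes on the
  -- diagonal, hence antisymmetric.
  det-swap : ∀ {n} {r s : Fin n} {M M′ : Matrix n} → r ≢ s → RowSwap r s M M′ → det M′ ≡ - det M
  det-swap {n} {r} {s} {M} {M′} r≢s swap = begin
    det M′                    ≡⟨ det-cong (withRows-unique r≢s at-r at-s elsewhere) ⟩
    D v u                     ≡⟨ cancel (D u v) (D v u) ⟩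
    - D u v + (D u v + D v u) ≡⟨ cong (λ z → - D u v + z) u+v-expansion ⟨
    - D u v + + 0             ≡⟨ ℤ.+-identityʳ (- D u v) ⟩
    - D u v                   ≡⟨ cong -_ (det-cong M≈Duv) ⟨
    - det M                   ∎
    where
    open RowSwap swap
    M≈Duv = withRows-unique r≢s (λ _ → refl) (λ _ → refl) (λ _ _ _ _ → refl)
    u = M r
    v = M s
    D : (x y : Fin n → ℤ) → ℤ
    D x y = det (withRows r s x y M)
    _⊕_ : (x y : Fin n → ℤ) → Fin n → ℤ
    (x ⊕ y) j = x j + y j
    cancel : ∀ a b → b ≡ - a + (a + b)
    cancel = solve-∀

    additiveˡ : ∀ x x′ y → D (x ⊕ x′) y ≡ D x y + D x′ y
    additiveˡ x x′ y = det-additive r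
      (λ j → trans (cong-app (withRows-r r s (x ⊕ x′) y M) j)
                   (sym (cong₂ _+_ (cong-app (withRows-r r s x y M) j) (cong-app (withRows-r r s x′ y M) j))))
      (λ i i≢r → cong-app (withRows-≢r i≢r x (x ⊕ x′) y M))
      (λ i i≢r → cong-app (withRows-≢r i≢r x′ (x ⊕ x′) y M))

    additiveʳ : ∀ x y y′ → D x (y ⊕ y′) ≡ D x y + D x y′
    additiveʳ x y y′ = det-additive s
      (λ j → trans (cong-app (withRows-s r≢s x (y ⊕ y′) M) j)
                   (sym (cong₂ _+_ (cong-app (withRows-s r≢s x y M) j) (cong-app (withRows-s r≢s x y′ M) j))))
      (λ i i≢s → cong-app (withRows-≢s i≢s x y (y ⊕ y′) M))
      (λ i i≢s → cong-app (withRows-≢s i≢s x y′ (y ⊕ y′) M))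

    D-diagonal : ∀ z → D z z ≡ + 0
    D-diagonal z = det-alternating (withRows r s z z M) r≢s λ j →
      trans (cong-app (withRows-r r s z z M) j) (sym (cong-app (withRows-s r≢s z z M) j))

    u+v-expansion : + 0 ≡ D u v + D v u
    u+v-expansion = begin
      + 0                                 ≡⟨ D-diagonal (u ⊕ v) ⟨
      D (u ⊕ v) (u ⊕ v)                   ≡⟨ additiveˡ u v (u ⊕ v) ⟩
      D u (u ⊕ v) + D v (u ⊕ v)           ≡⟨ cong₂ _+_ (additiveʳ u u v) (additiveʳ v u v) ⟩
      (D u u + D u v) + (D v u + D v v)
        ≡⟨ cong₂ (λ a b → (a + D u v) + (D v u + b)) (D-diagonal u) (D-diagonal v) ⟩
      (+ 0 + D u v) + (D v u + + 0)       ≡⟨ cong₂ _+_ (ℤ.+-identityˡ (D u v)) (ℤ.+-identityʳ (D v u)) ⟩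
      D u v + D v u                       ∎

det-factorRow : ∀ {n} {r s : Fin n} (c : ℤ) (v : Fin n → ℤ) (M : Matrix n) → r ≢ s →
                (∀ j → M r j ≡ c * v j + M s j) → det M ≡ c * det (updateAt M r (const v))
det-factorRow {r = r} {s} c v M r≢s Mr = begin
  det M                 ≡⟨ det-linear r c Mr′ (λ i i≢r → cong-app (updateAt-minimal i r M i≢r))
                                             (λ i i≢r → cong-app (updateAt-minimal i r M i≢r)) ⟩
  c * det U + det V     ≡⟨ cong (λ d → c * det U + d) (det-alternating V r≢s V-rows) ⟩
  c * det U + + 0       ≡⟨ ℤ.+-identityʳ (c * det U) ⟩
  c * det U             ∎
  where
  U = updateAt M r (const v)
  V = updateAt M r (const (M s))
  Mr′ : ∀ j → M r j ≡ c * U r j + V r j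
  Mr′ j = trans (Mr j) (sym (cong₂ (λ x y → c * x j + y j) (updateAt-updates r M) (updateAt-updates r M)))
  V-rows : ∀ j → V r j ≡ V s j
  V-rows = cong-app (trans (updateAt-updates r M) (sym (updateAt-minimal s r M (≢-sym r≢s))))

det-addRowMultiple : ∀ {n} {r s : Fin n} (c : ℤ) {M M′ : Matrix n} → r ≢ s →
                     (∀ j → M r j ≡ c * M s j + M′ r j) → (∀ i → i ≢ r → ∀ j → M′ i j ≡ M i j) →
                     det M ≡ det M′
det-addRowMultiple {r = r} {s} c {M} {M′} r≢s Mr M′≈M = begin
  det M              ≡⟨ det-linear r c Mr′ (λ i i≢r → cong-app (updateAt-minimal i r M i≢r)) M′≈M ⟩
  c * det U + det M′ ≡⟨ cong (λ d → c * d + det M′) (det-alternating U r≢s U-rows) ⟩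
  c * + 0 + det M′   ≡⟨ cong (_+ det M′) (ℤ.*-zeroʳ c) ⟩
  + 0 + det M′       ≡⟨ ℤ.+-identityˡ (det M′) ⟩
  det M′             ∎
  where
  U = updateAt M r (const (M s))
  Mr′ : ∀ j → M r j ≡ c * U r j + M′ r j
  Mr′ j = trans (Mr j) (cong (λ x → c * x + M′ r j) (sym (cong-app (updateAt-updates r M) j)))
  U-rows : ∀ j → U r j ≡ U s j
  U-rows = cong-app (trans (updateAt-updates r M) (sym (updateAt-minimal s r M (≢-sym r≢s))))

-- Integer polynomials have integer slopes; this is the only polynomial property the proof needs.
record HasIntegerSlopes (F : ℤ → ℤ) : Set where
  constructor integerSlopes
  field ∣-difference : ∀ a b → a - b ∣ F a - F b
open HasIntegerSlopes

slopes-cong : ∀ {F G} → (∀ t → F t ≡ G t) → HasIntegerSlopes F → HasIntegerSlopes G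
slopes-cong {F} {G} F≗G sF = integerSlopes λ a b →
  subst (a - b ∣_) (cong₂ _-_ (F≗G a) (F≗G b)) (∣-difference sF a b)

slopes-const : ∀ c → HasIntegerSlopes (const c)
slopes-const c = integerSlopes λ a b → subst (a - b ∣_) (sym (ℤ.+-inverseʳ c)) (divides (+ 0) refl)

slopes-id : HasIntegerSlopes (λ t → t)
slopes-id = integerSlopes λ a b → ∣-refl

slopes-diagonal : ∀ b → HasIntegerSlopes (λ t → if b then t else + 0)
slopes-diagonal true = slopes-id
slopes-diagonal false = slopes-const (+ 0)

slopes-+ : ∀ {F G} → HasIntegerSlopes F → HasIntegerSlopes G → HasIntegerSlopes (λ t → F t + G t)
slopes-+ {F} {G} sF sG = integerSlopes λ a b →
  subst (a - b ∣_) (sym (regroup (F a) (F b) (G a) (G b)))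
        (∣m∣n⇒∣m+n (∣-difference sF a b) (∣-difference sG a b))
  where
  regroup : ∀ x y z w → (x + z) - (y + w) ≡ (x - y) + (z - w)
  regroup = solve-∀

slopes-- : ∀ {F G} → HasIntegerSlopes F → HasIntegerSlopes G → HasIntegerSlopes (λ t → F t - G t)
slopes-- {F} {G} sF sG = integerSlopes λ a b →
  subst (a - b ∣_) (sym (regroup (F a) (F b) (G a) (G b)))
        (∣m∣n⇒∣m-n (∣-difference sF a b) (∣-difference sG a b))
  where
  regroup : ∀ x y z w → (x - z) - (y - w) ≡ (x - y) - (z - w)
  regroup = solve-∀

slopes-* : ∀ {F G} → HasIntegerSlopes F → HasIntegerSlopes G → HasIntegerSlopes (λ t → F t * G t)
slopes-* {F} {G} sF sG = integerSlopes λ a b →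
  subst (a - b ∣_) (sym (regroup (F a) (F b) (G a) (G b)))
        (∣m∣n⇒∣m+n (∣n⇒∣m*n (F a) (∣-difference sG a b)) (∣m⇒∣m*n (G b) (∣-difference sF a b)))
  where
  regroup : ∀ x y z w → x * z - y * w ≡ x * (z - w) + (x - y) * w
  regroup = solve-∀

slopes-Σℤ : ∀ {n} {G : Fin n → ℤ → ℤ} → (∀ j → HasIntegerSlopes (G j)) →
            HasIntegerSlopes (λ t → Σℤ (λ j → G j t))
slopes-Σℤ {zero} sG = slopes-const (+ 0)
slopes-Σℤ {suc n} sG = slopes-+ (sG zero) (slopes-Σℤ (sG ∘ suc))

slopes-Πℤ : ∀ {n} {G : Fin n → ℤ → ℤ} → (∀ j → HasIntegerSlopes (G j)) →
            HasIntegerSlopes (λ t → Πℤ (λ j → G j t))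
slopes-Πℤ {zero} sG = slopes-const (+ 1)
slopes-Πℤ {suc n} sG = slopes-* (sG zero) (slopes-Πℤ (sG ∘ suc))

slopes-det : ∀ {n} {M : ℤ → Matrix n} → (∀ i j → HasIntegerSlopes (λ t → M t i j)) →
             HasIntegerSlopes (λ t → det (M t))
slopes-det {zero} sM = slopes-const (+ 1)
slopes-det {suc n} sM = slopes-Σℤ λ j →
  slopes-* (slopes-* (slopes-const (sign j)) (sM zero j)) (slopes-det λ r c → sM (suc r) (punchIn j c))

suc-∣⇒0 : ∀ {n} → suc n ∣ℕ n → n ≡ 0
suc-∣⇒0 {zero} _ = refl
suc-∣⇒0 {suc n} sn∣n = ⊥-elim (>⇒∤ (ℕ.n<1+n (suc n)) sn∣n)

-- For m = 1 + ∣ F α ∣ the slope between α + m and α gives m ∣ F α.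
slopes-vanish : ∀ {F} (α : ℤ) → HasIntegerSlopes F → (∀ t → t ≢ α → F t ≡ + 0) → F α ≡ + 0
slopes-vanish {F} α sF F≡0 = ℤ.∣i∣≡0⇒i≡0 (suc-∣⇒0 (∣⇒∣ᵤ m∣Fα))
  where
  m = suc ∣ F α ∣
  shift : ∀ a x → (a + x) - a ≡ x
  shift = solve-∀
  α+m≢α : α + + m ≢ α
  α+m≢α eq with trans (sym (shift α (+ m))) (trans (cong (_- α) eq) (ℤ.+-inverseʳ α))
  ... | ()
  m∣-Fα : + m ∣ - F α
  m∣-Fα = subst₂ _∣_ (shift α (+ m)) (trans (cong (_- F α) (F≡0 _ α+m≢α)) (ℤ.+-identityˡ (- F α)))
                 (∣-difference sF (α + + m) α)
  m∣Fα : + m ∣ F α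
  m∣Fα = subst (+ m ∣_) (ℤ.neg-involutive (F α)) (∣m⇒∣-m m∣-Fα)

slopes-cancelFactor : ∀ {D Q} (α : ℤ) → HasIntegerSlopes D → HasIntegerSlopes Q →
                      (∀ t → (t - α) * D t ≡ (t - α) * Q t) → ∀ t → D t ≡ Q t
slopes-cancelFactor {D} {Q} α sD sQ factor t = ℤ.i-j≡0⇒i≡j (D t) (Q t) (byCases (t ℤ.≟ α))
  where
  away : ∀ t → t ≢ α → D t - Q t ≡ + 0
  away t t≢α = ℤ.i≡j⇒i-j≡0 (ℤ.*-cancelˡ-≡ (t - α) (D t) (Q t) {{t-α≢0}} (factor t))
    where
    t-α≢0 = ℤ.≢-nonZero (t≢α ∘ ℤ.i-j≡0⇒i≡j t α)
  byCases : Dec (t ≡ α) → D t - Q t ≡ + 0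
  byCases (yes refl) = slopes-vanish α (slopes-- sD sQ) away
  byCases (no t≢α) = away t t≢α

-- IntegralSpectrum M unfolds to Splits n (charPoly M).
Splits : ℕ → (ℤ → ℤ) → Set
Splits n P = Σ (Fin n → ℤ) λ roots → ∀ t → P t ≡ Πℤ (λ i → t - roots i)

splits-root : ∀ {n} {P : ℤ → ℤ} {α : ℤ} ((roots , P≡Π) : Splits n P) → P α ≡ + 0 →
              Σ (Fin n) λ k → roots k ≡ α
splits-root {α = α} (roots , P≡Π) Pα≡0
  with Πℤ≡0⇒∃zero (λ i → α - roots i) (trans (sym (P≡Π α)) Pα≡0)
... | k , α-rootₖ≡0 = k , sym (ℤ.i-j≡0⇒i≡j α (roots k) α-rootₖ≡0)

linearFactor-vanishes : ∀ {D P : ℤ → ℤ} (α : ℤ) → (∀ t → P t ≡ (t - α) * D t) → P α ≡ + 0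
linearFactor-vanishes {D} α P≡ = trans (P≡ α) (trans (cong (_* D α) (ℤ.+-inverseʳ α)) (ℤ.*-zeroˡ (D α)))

splits-replaceRoot : ∀ {n} {D P P′ : ℤ → ℤ} (α β : ℤ) → HasIntegerSlopes D →
                     (∀ t → P t ≡ (t - α) * D t) → (∀ t → P′ t ≡ (t - β) * D t) →
                     Splits n P → Splits n P′
splits-replaceRoot {zero} α β sD P≡ P′≡ split with splits-root split (linearFactor-vanishes α P≡)
... | () , _
splits-replaceRoot {suc n} {D} {P} {P′} α β sD P≡ P′≡ split@(roots , P≡Π)
  with splits-root split (linearFactor-vanishes α P≡)
... | k , rootₖ≡α = roots′ , P′≡Π′
  where
  roots′ = updateAt roots k (const β)
  Q : ℤ → ℤ
  Q t = Πℤ (λ i → t - roots (punchIn k i))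
  P≡αQ : ∀ t → (t - α) * D t ≡ (t - α) * Q t
  P≡αQ t = begin
    (t - α) * D t                  ≡⟨ P≡ t ⟨
    P t                            ≡⟨ P≡Π t ⟩
    Πℤ (λ i → t - roots i)         ≡⟨ Πℤ-remove (λ i → t - roots i) k ⟩
    (t - roots k) * Q t            ≡⟨ cong (λ r → (t - r) * Q t) rootₖ≡α ⟩
    (t - α) * Q t                  ∎
  D≡Q : ∀ t → D t ≡ Q t
  D≡Q = slopes-cancelFactor α sD (slopes-Πℤ λ i → slopes-- slopes-id (slopes-const (roots (punchIn k i))))
                            P≡αQ
  P′≡Π′ : ∀ t → P′ t ≡ Πℤ (λ i → t - roots′ i)
  P′≡Π′ t = begin
    P′ t
      ≡⟨ P′≡ t ⟩
    (t - β) * D t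
      ≡⟨ cong₂ (λ r d → (t - r) * d) (sym (updateAt-updates k roots)) (D≡Q t) ⟩
    (t - roots′ k) * Q t
      ≡⟨ cong ((t - roots′ k) *_) (Πℤ-cong λ i →
           cong (λ r → t - r) (sym (updateAt-minimal _ k roots (punchInᵢ≢i k i)))) ⟩
    (t - roots′ k) * Πℤ (λ i → t - roots′ (punchIn k i))
      ≡⟨ Πℤ-remove (λ i → t - roots′ i) k ⟨
    Πℤ (λ i → t - roots′ i) ∎

δ : ∀ {n} → Fin n → Fin n → ℤ
δ i j = if i == j then + 1 else + 0

δ-refl : ∀ {n} (i : Fin n) → δ i i ≡ + 1
δ-refl i rewrite ==-refl i = refl

δ-≢ : ∀ {n} {i j : Fin n} → i ≢ j → δ i j ≡ + 0
δ-≢ i≢j rewrite ==-≢ i≢j = refl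

adjℤ : ∀ {n} → Adj n → Matrix n
adjℤ a i j = if a i j then + 1 else + 0

weight : ∀ {n} → Adj n → (Fin n → ℕ) → Fin n → ℕ
weight a f i = deg a i ℕ.+ 2 ℕ.* f i

charMatrix : ∀ {n} → Matrix n → ℤ → Matrix n
charMatrix M t i j = (if i == j then t else + 0) - M i j

charMatrix-Qmat : ∀ {n} (a : Adj n) f t (i j : Fin n) →
                  charMatrix (Qmat a f) t i j ≡ (t - + weight a f i) * δ i j - adjℤ a i j
charMatrix-Qmat a f t i j = entry (i == j)
  where
  entry : ∀ d → (if d then t else + 0) - (adjℤ a i j + (if d then + weight a f i else + 0))
              ≡ (t - + weight a f i) * (if d then + 1 else + 0) - adjℤ a i j
  entry true = diagonal t (adjℤ a i j) (+ weight a f i)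
    where
    diagonal : ∀ t x w → t - (x + w) ≡ (t - w) * + 1 - x
    diagonal = solve-∀
  entry false = offDiagonal t (adjℤ a i j) (+ weight a f i)
    where
    offDiagonal : ∀ t x w → + 0 - (x + + 0) ≡ (t - w) * + 0 - x
    offDiagonal = solve-∀

degreeTwo-nonNeighbour : ∀ {n} (a : Adj n) {x y z w : Fin n} → deg a x ≡ 2 → a x y ≡ true → a x z ≡ true →
                         z ≢ y → w ≢ y → w ≢ z → a x w ≡ false
degreeTwo-nonNeighbour a {x} {y} {z} {w} deg≡2 axy axz z≢y w≢y w≢z with a x w in axw
... | false = refl
... | true = ⊥-elim (3≰2 (subst (3 ≤_) deg≡2 three≤deg))
  where
  3≰2 : ¬ 3 ≤ 2
  3≰2 (ℕ.s≤s (ℕ.s≤s ()))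
  indicator : ∀ {b} → b ≡ true → (if b then 1 else 0) ≡ 1
  indicator refl = refl
  three≤deg : 3 ≤ deg a x
  three≤deg = subst (_≤ deg a x) (cong₂ ℕ._+_ (indicator axy) (cong₂ ℕ._+_ (indicator axz) (indicator axw)))
                    (Σℕ-≥-three (λ j → if a x j then 1 else 0) z≢y w≢y w≢z)

adjℤ-degreeTwo : ∀ {n} (a : Adj n) {x y z : Fin n} → deg a x ≡ 2 → a x y ≡ true → a x z ≡ true → z ≢ y →
                 ∀ j → adjℤ a x j ≡ δ y j + δ z j
adjℤ-degreeTwo a {x} {y} {z} deg≡2 axy axz z≢y j = byCases (j ≟ y) (j ≟ z)
  where
  byCases : Dec (j ≡ y) → Dec (j ≡ z) → adjℤ a x j ≡ δ y j + δ z j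
  byCases (yes refl) _ rewrite axy | δ-refl j | δ-≢ z≢y = refl
  byCases (no j≢y) (yes refl) rewrite axz | δ-refl j | δ-≢ (≢-sym z≢y) = refl
  byCases (no j≢y) (no j≢z)
    rewrite degreeTwo-nonNeighbour a deg≡2 axy axz z≢y j≢y j≢z | δ-≢ (≢-sym j≢y) | δ-≢ (≢-sym j≢z) = refl

deleteEdge-row : ∀ {n} (a : Adj n) {x y : Fin n} → x ≢ y → ∀ j → deleteEdge a x y x j ≡ a x j ∧ not (j == y)
deleteEdge-row a {x} {y} x≢y j rewrite ==-refl x | ==-≢ x≢y | ∨-identityʳ (j == y) = refl

deleteEdge-comm : ∀ {n} (a : Adj n) (x y i j : Fin n) → deleteEdge a x y i j ≡ deleteEdge a y x i j
deleteEdge-comm a x y i j = cong (λ b → a i j ∧ not b) (∨-comm (i == x ∧ j == y) (i == y ∧ j == x))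

deleteEdge-elsewhere : ∀ {n} (a : Adj n) {x y i : Fin n} → i ≢ x → i ≢ y → ∀ j → deleteEdge a x y i j ≡ a i j
deleteEdge-elsewhere a i≢x i≢y j rewrite ==-≢ i≢x | ==-≢ i≢y = ∧-identityʳ _

adjℤ-deleteEdge : ∀ {n} (a : Adj n) {x y : Fin n} → x ≢ y → a x y ≡ true →
                  ∀ j → adjℤ (deleteEdge a x y) x j ≡ adjℤ a x j - δ y j
adjℤ-deleteEdge a {x} {y} x≢y axy j =
  trans (cong (λ b → if b then + 1 else + 0) (deleteEdge-row a x≢y j)) (byCases (j ≟ y))
  where
  byCases : Dec (j ≡ y) → (if a x j ∧ not (j == y) then + 1 else + 0) ≡ adjℤ a x j - δ y j
  byCases (yes refl) rewrite axy | ==-refl j = refl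
  byCases (no j≢y) rewrite ==-≢ j≢y | δ-≢ (≢-sym j≢y) | ∧-identityʳ (a x j) =
    sym (ℤ.+-identityʳ (adjℤ a x j))

deg-deleteEdge : ∀ {n} (a : Adj n) {x y : Fin n} → x ≢ y → a x y ≡ true →
                 deg a x ≡ suc (deg (deleteEdge a x y) x)
deg-deleteEdge a {x} {y} x≢y axy = begin
  deg a x                          ≡⟨ Σℕ-split g y ⟩
  g y ℕ.+ Σℕ (dropAt y g)          ≡⟨ cong₂ ℕ._+_ (cong ind axy) (Σℕ-cong dropsAgree) ⟩
  1 ℕ.+ Σℕ (dropAt y g̃)            ≡⟨ cong (λ d → suc (d ℕ.+ Σℕ (dropAt y g̃))) g̃y≡0 ⟨
  suc (g̃ y ℕ.+ Σℕ (dropAt y g̃))    ≡⟨ cong suc (Σℕ-split g̃ y) ⟨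
  suc (deg (deleteEdge a x y) x)   ∎
  where
  ind : Bool → ℕ
  ind b = if b then 1 else 0
  g g̃ : Fin _ → ℕ
  g j = ind (a x j)
  g̃ j = ind (deleteEdge a x y x j)
  g̃y≡0 : g̃ y ≡ 0
  g̃y≡0 rewrite deleteEdge-row a x≢y y | ==-refl y | ∧-zeroʳ (a x y) = refl
  dropMasked : ∀ b c → (if b then 0 else ind c) ≡ (if b then 0 else ind (c ∧ not b))
  dropMasked true c = refl
  dropMasked false c = cong ind (sym (∧-identityʳ c))
  dropsAgree : ∀ i → dropAt y g i ≡ dropAt y g̃ i
  dropsAgree i rewrite deleteEdge-row a x≢y i = dropMasked (i == y) (a x i)

reweight-x : ∀ {n} (f : Fin n → ℕ) (x y : Fin n) → reweight f x y x ≡ 1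
reweight-x f x y rewrite ==-refl x = refl

reweight-y : ∀ {n} (f : Fin n → ℕ) (x y : Fin n) → reweight f x y y ≡ 1
reweight-y f x y rewrite ==-refl y | ∨-zeroʳ (y == x) = refl

reweight-elsewhere : ∀ {n} (f : Fin n → ℕ) {x y i : Fin n} → i ≢ x → i ≢ y → reweight f x y i ≡ f i
reweight-elsewhere f i≢x i≢y rewrite ==-≢ i≢x | ==-≢ i≢y = refl

module TriangleReduction {n} (a : Adj n) (f : Fin n → ℕ) (symmetric : ∀ i j → a i j ≡ a j i)
  {x₁ x₂ x₃ : Fin n} (x₁≢x₂ : x₁ ≢ x₂) (x₁≢x₃ : x₁ ≢ x₃) (x₂≢x₃ : x₂ ≢ x₃)
  (a₁₂ : a x₁ x₂ ≡ true) (a₁₃ : a x₁ x₃ ≡ true) (a₂₃ : a x₂ x₃ ≡ true)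
  (deg₁ : deg a x₁ ≡ 2) (deg₂ : deg a x₂ ≡ 2) (f₁ : f x₁ ≡ 0) (f₂ : f x₂ ≡ 0) where

  ã : Adj n
  ã = deleteEdge a x₁ x₂

  f̃ : Fin n → ℕ
  f̃ = reweight f x₁ x₂

  M M̃ : ℤ → Matrix n
  M = charMatrix (Qmat a f)
  M̃ = charMatrix (Qmat ã f̃)

  a₂₁ : a x₂ x₁ ≡ true
  a₂₁ = trans (symmetric x₂ x₁) a₁₂

  x₂≢x₁ : x₂ ≢ x₁
  x₂≢x₁ = ≢-sym x₁≢x₂

  degã₁ : deg ã x₁ ≡ 1
  degã₁ = ℕ.suc-injective (trans (sym (deg-deleteEdge a x₁≢x₂ a₁₂)) deg₁)

  degã₂ : deg ã x₂ ≡ 1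
  degã₂ = trans (Σℕ-cong λ j → cong (λ b → if b then 1 else 0) (deleteEdge-comm a x₁ x₂ x₂ j))
                (ℕ.suc-injective (trans (sym (deg-deleteEdge a x₂≢x₁ a₂₁)) deg₂))

  weight₁ : weight a f x₁ ≡ 2
  weight₁ = cong₂ (λ d w → d ℕ.+ 2 ℕ.* w) deg₁ f₁

  weight₂ : weight a f x₂ ≡ 2
  weight₂ = cong₂ (λ d w → d ℕ.+ 2 ℕ.* w) deg₂ f₂

  weightã₁ : weight ã f̃ x₁ ≡ 3
  weightã₁ = cong₂ (λ d w → d ℕ.+ 2 ℕ.* w) degã₁ (reweight-x f x₁ x₂)

  weightã₂ : weight ã f̃ x₂ ≡ 3
  weightã₂ = cong₂ (λ d w → d ℕ.+ 2 ℕ.* w) degã₂ (reweight-y f x₁ x₂)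

  M-row₁ : ∀ t j → M t x₁ j ≡ (t - + 2) * δ x₁ j - (δ x₂ j + δ x₃ j)
  M-row₁ t j = trans (charMatrix-Qmat a f t x₁ j)
    (cong₂ (λ w A → (t - + w) * δ x₁ j - A) weight₁ (adjℤ-degreeTwo a deg₁ a₁₂ a₁₃ (≢-sym x₂≢x₃) j))

  M-row₂ : ∀ t j → M t x₂ j ≡ (t - + 2) * δ x₂ j - (δ x₁ j + δ x₃ j)
  M-row₂ t j = trans (charMatrix-Qmat a f t x₂ j)
    (cong₂ (λ w A → (t - + w) * δ x₂ j - A) weight₂ (adjℤ-degreeTwo a deg₂ a₂₁ a₂₃ (≢-sym x₁≢x₃) j))

  M̃-row₁ : ∀ t j → M̃ t x₁ j ≡ (t - + 3) * δ x₁ j - (δ x₂ j + δ x₃ j - δ x₂ j)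
  M̃-row₁ t j = trans (charMatrix-Qmat ã f̃ t x₁ j)
    (cong₂ (λ w A → (t - + w) * δ x₁ j - A) weightã₁
           (trans (adjℤ-deleteEdge a x₁≢x₂ a₁₂ j)
                  (cong (_- δ x₂ j) (adjℤ-degreeTwo a deg₁ a₁₂ a₁₃ (≢-sym x₂≢x₃) j))))

  M̃-row₂ : ∀ t j → M̃ t x₂ j ≡ (t - + 3) * δ x₂ j - (δ x₁ j + δ x₃ j - δ x₁ j)
  M̃-row₂ t j = trans (charMatrix-Qmat ã f̃ t x₂ j)
    (cong₂ (λ w A → (t - + w) * δ x₂ j - A) weightã₂
           (trans (cong (λ b → if b then + 1 else + 0) (deleteEdge-comm a x₁ x₂ x₂ j))
           (trans (adjℤ-deleteEdge a x₂≢x₁ a₂₁ j)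
                  (cong (_- δ x₁ j) (adjℤ-degreeTwo a deg₂ a₂₁ a₂₃ (≢-sym x₁≢x₃) j)))))

  M̃-elsewhere : ∀ t {i} → i ≢ x₁ → i ≢ x₂ → ∀ j → M̃ t i j ≡ M t i j
  M̃-elsewhere t {i} i≢x₁ i≢x₂ j = begin
    M̃ t i j                                   ≡⟨ charMatrix-Qmat ã f̃ t i j ⟩
    (t - + weight ã f̃ i) * δ i j - adjℤ ã i j ≡⟨ cong₂ (λ w A → (t - + w) * δ i j - A) weight≡ (adjℤ≡ j) ⟩
    (t - + weight a f i) * δ i j - adjℤ a i j ≡⟨ charMatrix-Qmat a f t i j ⟨
    M t i j                                   ∎
    where
    adjℤ≡ : ∀ k → adjℤ ã i k ≡ adjℤ a i k
    adjℤ≡ k = cong (λ b → if b then + 1 else + 0) (deleteEdge-elsewhere a i≢x₁ i≢x₂ k)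
    weight≡ : weight ã f̃ i ≡ weight a f i
    weight≡ = cong₂ (λ d w → d ℕ.+ 2 ℕ.* w)
                    (Σℕ-cong λ k → cong (λ b → if b then 1 else 0) (deleteEdge-elsewhere a i≢x₁ i≢x₂ k))
                    (reweight-elsewhere f i≢x₁ i≢x₂)

  e : Fin n → ℤ
  e j = δ x₁ j - δ x₂ j

  N Ñ : ℤ → Matrix n
  N t = updateAt (M t) x₁ (const e)
  Ñ t = updateAt (M̃ t) x₁ (const e)

  charPoly-factor : ∀ t → charPoly (Qmat a f) t ≡ (t - + 1) * det (N t)
  charPoly-factor t = det-factorRow (t - + 1) e (M t) x₁≢x₂ λ j → begin
    M t x₁ j                                      ≡⟨ M-row₁ t j ⟩
    (t - + 2) * δ x₁ j - (δ x₂ j + δ x₃ j)        ≡⟨ identity t (δ x₁ j) (δ x₂ j) (δ x₃ j) ⟩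
    (t - + 1) * e j + ((t - + 2) * δ x₂ j - (δ x₁ j + δ x₃ j))
                                                  ≡⟨ cong (λ r → (t - + 1) * e j + r) (M-row₂ t j) ⟨
    (t - + 1) * e j + M t x₂ j                    ∎
    where
    identity : ∀ t d₁ d₂ d₃ →
               (t - + 2) * d₁ - (d₂ + d₃) ≡ (t - + 1) * (d₁ - d₂) + ((t - + 2) * d₂ - (d₁ + d₃))
    identity = solve-∀

  det-N≡det-Ñ : ∀ t → det (N t) ≡ det (Ñ t)
  det-N≡det-Ñ t = det-addRowMultiple (- + 1) x₂≢x₁ row₂ agree
    where
    identity : ∀ t d₁ d₂ d₃ →
               (t - + 2) * d₂ - (d₁ + d₃) ≡ - + 1 * (d₁ - d₂) + ((t - + 3) * d₂ - (d₁ + d₃ - d₁))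
    identity = solve-∀
    row₂ : ∀ j → N t x₂ j ≡ - + 1 * N t x₁ j + Ñ t x₂ j
    row₂ j = begin
      N t x₂ j                   ≡⟨ cong-app (updateAt-minimal x₂ x₁ (M t) x₂≢x₁) j ⟩
      M t x₂ j                   ≡⟨ M-row₂ t j ⟩
      (t - + 2) * δ x₂ j - (δ x₁ j + δ x₃ j)
        ≡⟨ identity t (δ x₁ j) (δ x₂ j) (δ x₃ j) ⟩
      - + 1 * e j + ((t - + 3) * δ x₂ j - (δ x₁ j + δ x₃ j - δ x₁ j))
        ≡⟨ cong₂ (λ u v → - + 1 * u + v) (cong-app (updateAt-updates x₁ (M t)) j)
                 (trans (cong-app (updateAt-minimal x₂ x₁ (M̃ t) x₂≢x₁) j) (M̃-row₂ t j)) ⟨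
      - + 1 * N t x₁ j + Ñ t x₂ j ∎
    agree : ∀ i → i ≢ x₂ → ∀ j → Ñ t i j ≡ N t i j
    agree i i≢x₂ j with i ≟ x₁
    ... | yes refl = cong-app (trans (updateAt-updates x₁ (M̃ t)) (sym (updateAt-updates x₁ (M t)))) j
    ... | no i≢x₁ = begin
      Ñ t i j  ≡⟨ cong-app (updateAt-minimal i x₁ (M̃ t) i≢x₁) j ⟩
      M̃ t i j  ≡⟨ M̃-elsewhere t i≢x₁ i≢x₂ j ⟩
      M t i j  ≡⟨ cong-app (updateAt-minimal i x₁ (M t) i≢x₁) j ⟨
      N t i j  ∎

  charPolỹ-factor : ∀ t → charPoly (Qmat ã f̃) t ≡ (t - + 3) * det (N t)
  charPolỹ-factor t = begin
    det (M̃ t)                 ≡⟨ det-factorRow (t - + 3) e (M̃ t) x₁≢x₂ row₁ ⟩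
    (t - + 3) * det (Ñ t)     ≡⟨ cong ((t - + 3) *_) (det-N≡det-Ñ t) ⟨
    (t - + 3) * det (N t)     ∎
    where
    identity : ∀ t d₁ d₂ d₃ →
               (t - + 3) * d₁ - (d₂ + d₃ - d₂) ≡ (t - + 3) * (d₁ - d₂) + ((t - + 3) * d₂ - (d₁ + d₃ - d₁))
    identity = solve-∀
    row₁ : ∀ j → M̃ t x₁ j ≡ (t - + 3) * e j + M̃ t x₂ j
    row₁ j = begin
      M̃ t x₁ j                                      ≡⟨ M̃-row₁ t j ⟩
      (t - + 3) * δ x₁ j - (δ x₂ j + δ x₃ j - δ x₂ j) ≡⟨ identity t (δ x₁ j) (δ x₂ j) (δ x₃ j) ⟩
      (t - + 3) * e j + ((t - + 3) * δ x₂ j - (δ x₁ j + δ x₃ j - δ x₁ j))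
                                                    ≡⟨ cong (λ r → (t - + 3) * e j + r) (M̃-row₂ t j) ⟨
      (t - + 3) * e j + M̃ t x₂ j                    ∎

  slopes-det-N : HasIntegerSlopes (λ t → det (N t))
  slopes-det-N = slopes-det λ i j → entry i j (i ≟ x₁)
    where
    entry : ∀ i j → Dec (i ≡ x₁) → HasIntegerSlopes (λ t → N t i j)
    entry i j (yes refl) = slopes-cong (λ t → sym (cong-app (updateAt-updates x₁ (M t)) j))
                                       (slopes-const (e j))
    entry i j (no i≢x₁) = slopes-cong (λ t → sym (cong-app (updateAt-minimal i x₁ (M t) i≢x₁) j))
                                      (slopes-- (slopes-diagonal (i == j)) (slopes-const (Qmat a f i j)))

proposition3p17 : (n : ℕ) (a : Adj n) (f : Fin n → ℕ) →
    IsSimple a → Connected a →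
    (x₁ x₂ x₃ : Fin n) → x₁ ≢ x₂ → x₁ ≢ x₃ → x₂ ≢ x₃ →
    a x₁ x₂ ≡ true → a x₁ x₃ ≡ true → a x₂ x₃ ≡ true →
    deg a x₁ ≡ 2 → deg a x₂ ≡ 2 → f x₁ ≡ 0 → f x₂ ≡ 0 →
    IntegralSpectrum (Qmat a f)
      ⇔ IntegralSpectrum (Qmat (deleteEdge a x₁ x₂) (reweight f x₁ x₂))
proposition3p17 n a f (symmetric , _) _ x₁ x₂ x₃ x₁≢x₂ x₁≢x₃ x₂≢x₃ a₁₂ a₁₃ a₂₃ deg₁ deg₂ f₁ f₂ =
  mk⇔ (splits-replaceRoot (+ 1) (+ 3) slopes-det-N charPoly-factor charPolỹ-factor)
      (splits-replaceRoot (+ 3) (+ 1) slopes-det-N charPolỹ-factor charPoly-factor)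
  where open TriangleReduction a f symmetric x₁≢x₂ x₁≢x₃ x₂≢x₃ a₁₂ a₁₃ a₂₃ deg₁ deg₂ f₁ f₂
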